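{- Let $Ax$ be a set of connecting principles containing $(\Box\text{ -access})$ and $(\bigcirc\text{ -left})$. For every agent $i$, formula $\phi$ and term $t$ there is a term $s(t)$ such that $[t]_i\Box\phi\to[s(t)]_i\bigcirc\phi$ is provable in $\mathsf{LPLTL}^{\mathsf P}(Ax)_{\emptyset}$ (i.e. with the empty constant specification).
   Context: Language. Fix $h\ge 1$ agents $\mathsf{Ag}=\{1,\dots,h\}$ and countable sets of justification constants, variables, and atomic propositions $\mathsf{Prop}$. Terms: $t::=c\mid x\mid\ !t\mid t+t\mid t\cdot t\mid \Uparrow t\mid\Downarrow t\mid\downarrow t\mid\Rrightarrow t\mid\Lleftarrow t\mid\Uparrow_P t\mid\Downarrow_P t\mid\downarrow_P t\mid\Rightarrow_P t\mid\Rrightarrow_P t\mid\Lleftarrow_P t$. Formulas: $\phi::=P\mid\bot\mid\phi\to\phi\mid\bigcirc\phi\mid\mathsf{Y}_w\phi\mid\phi\,\mathcal{U}\,\phi\mid\phi\,\mathcal{S}\,\phi\mid[t]_i\phi$ ($\bigcirc$ next, $\mathsf{Y}_w$ weak previous, $\mathcal U$ until, $\mathcal S$ since). Abbreviations: $\neg\phi:=\phi\to\bot$, $\top:=\neg\bot$, usual $\lor,\land,\leftrightarrow$; $\mathsf{Y}_s\phi:=\neg\mathsf{Y}_w\neg\phi$; $\Diamond\phi:=\top\,\mathcal U\,\phi$; $\Box\phi:=\neg\Diamond\neg\phi$; $\Diamond^{ - }\phi:=\top\,\mathcal S\,\phi$; $\boxminus\phi:=\neg\Diamond^{ - }\neg\phi$.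 Base system $\mathsf{LPLTL}^{\mathsf P}$. Axioms: all propositional tautologies; $\bigcirc(\phi\to\psi)\to(\bigcirc\phi\to\bigcirc\psi)$; $\Box(\phi\to\psi)\to(\Box\phi\to\Box\psi)$; $\bigcirc\neg\phi\leftrightarrow\neg\bigcirc\phi$; $\Box(\phi\to\bigcirc\phi)\to(\phi\to\Box\phi)$; $\phi\,\mathcal U\,\psi\to\Diamond\psi$; $\phi\,\mathcal U\,\psi\leftrightarrow\psi\lor(\phi\land\bigcirc(\phi\,\mathcal U\,\psi))$; $\boxminus(\phi\to\psi)\to(\boxminus\phi\to\boxminus\psi)$; $\mathsf Y_w(\phi\to\psi)\to(\mathsf Y_w\phi\to\mathsf Y_w\psi)$; $\mathsf Y_s\phi\to\mathsf Y_w\phi$; $\phi\to\bigcirc\mathsf Y_s\phi$; $\phi\to\mathsf Y_w\bigcirc\phi$; $\Diamond^{ - }\mathsf Y_w\bot$; $\boxminus(\phi\to\mathsf Y_w\phi)\to(\phi\to\boxminus\phi)$; $\phi\,\mathcal S\,\psi\to\Diamond^{ - }\psi$; $\phi\,\mathcal S\,\psi\leftrightarrow\psi\lor(\phi\land\mathsf Y_s(\phi\,\mathcal S\,\psi))$; and for all agents $i$, terms $s,t$: $[t]_i(\phi\to\psi)\to([s]_i\phi\to[t\cdot s]_i\psi)$; $[t]_i\phi\to[t+s]_i\phi$ and $[s]_i\phi\to[t+s]_i\phi$; $[t]_i\phi\to\phi$; $[t]_i\phi\to[!t]_i[t]_i\phi$. Rules: modus ponens; from $\vdash\phi$ infer each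 of $\vdash\bigcirc\phi$, $\vdash\mathsf Y_w\phi$, $\vdash\Box\phi$, $\vdash\boxminus\phi$; and $\vdash\psi$ for every $\psi$ in the constant specification (here empty). Connecting principles (for all agents $i$, terms $t$, formulas $\phi$): (generalize) $\Box[t]_i\phi\to[\Uparrow t]_i\Box\phi$; ($\Box$-access) $[t]_i\Box\phi\to\Box[\Downarrow t]_i\phi$; ($\bigcirc$-access) $[t]_i\Box\phi\to[\downarrow t]_i\bigcirc\phi$; ($\bigcirc$-right) $[t]_i\bigcirc\phi\to\bigcirc[\Rrightarrow t]_i\phi$; ($\bigcirc$-left) $\bigcirc[t]_i\phi\to[\Lleftarrow t]_i\bigcirc\phi$; ($\boxminus$-generalize) $\boxminus[t]_i\phi\to[\Uparrow_P t]_i\boxminus\phi$; ($\boxminus$-access) $[t]_i\boxminus\phi\to\boxminus[\Downarrow_P t]_i\phi$; ($\mathsf Y_w$-access) $[t]_i\boxminus\phi\to[\downarrow_P t]_i\mathsf Y_w\phi$; ($\mathsf Y_w$-right) $[t]_i\mathsf Y_w\phi\to\mathsf Y_w[\Rightarrow_P t]_i\phi$; ($\mathsf Y_s$-right) $[t]_i\mathsf Y_s\phi\to\mathsf Y_s[\Rrightarrow_P t]_i\phi$; ($\mathsf Y_s$-left) $\mathsf Y_s[t]_i\phi\to[\Lleftarrow_P t]_i\mathsf Y_s\phi$. $\mathsf{LPLTL}^{\mathsf P}(Ax)$ is $\mathsf{LPLTL}^{\mathsf P}$ plus the axioms in $Ax$. -}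

module Defs where

open import Data.Nat using (ℕ)
open import Data.Fin using (Fin)
open import Data.Bool using (Bool; true; false; _∨_; not)
open import Relation.Binary.PropositionalEquality using (_≡_)
open import Data.Empty using (⊥)

data Term : Set where
  con   : ℕ → Term
  var   : ℕ → Term
  !_    : Term → Term
  _⊕_   : Term → Term → Term
  _⊙_   : Term → Term → Term
  ⇑     : Term → Term
  ⇓     : Term → Term
  ↓     : Term → Term
  ⇛     : Term → Term
  ⇚     : Term → Term
  ⇑P    : Term → Term
  ⇓P    : Term → Term
  ↓P    : Term → Term
  ⇒P    : Term → Term
  ⇛P    : Term → Term
  ⇚P    : Term → Term

data Fm (h : ℕ) : Set where
  atom : ℕ → Fm h
  ⊥'   : Fm h
  _⇒_  : Fm h → Fm h → Fm h
  ○    : Fm h → Fm h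
  Yw   : Fm h → Fm h
  _𝒰_  : Fm h → Fm h → Fm h
  _𝒮_  : Fm h → Fm h → Fm h
  [_]_∶_ : Term → Fin h → Fm h → Fm h

infixr 5 _⇒_

module _ {h : ℕ} where
  ¬' : Fm h → Fm h
  ¬' φ = φ ⇒ ⊥'

  ⊤' : Fm h
  ⊤' = ¬' ⊥'

  _∨'_ : Fm h → Fm h → Fm h
  φ ∨' ψ = ¬' φ ⇒ ψ

  _∧'_ : Fm h → Fm h → Fm h
  φ ∧' ψ = ¬' (φ ⇒ ¬' ψ)

  _⇔_ : Fm h → Fm h → Fm h
  φ ⇔ ψ = (φ ⇒ ψ) ∧' (ψ ⇒ φ)

  Ys : Fm h → Fm h
  Ys φ = ¬' (Yw (¬' φ))

  ◇ : Fm h → Fm h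
  ◇ φ = ⊤' 𝒰 φ

  □ : Fm h → Fm h
  □ φ = ¬' (◇ (¬' φ))

  ◇⁻ : Fm h → Fm h
  ◇⁻ φ = ⊤' 𝒮 φ

  ⊟ : Fm h → Fm h
  ⊟ φ = ¬' (◇⁻ (¬' φ))

  -- Propositional tautologies: formulas true under every Boolean valuation
  -- of their maximal non-propositional subformulas (⊥ and → are the only
  -- propositional primitives; all other formulas are treated as atoms).
  eval : (Fm h → Bool) → Fm h → Bool
  eval v ⊥'      = false
  eval v (φ ⇒ ψ) = not (eval v φ) ∨ eval v ψ
  eval v φ       = v φ

  Tautology : Fm h → Set
  Tautology φ = (v : Fm h → Bool) → eval v φ ≡ true

data Principle : Set where
  generalize ⊟-generalize : Principle
  □-access ○-access ○-right ○-left : Principle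
  ⊟-access Yw-access Yw-right Ys-right Ys-left : Principle

principle : {h : ℕ} → Principle → Fin h → Term → Fm h → Fm h
principle generalize   i t φ = □ ([ t ] i ∶ φ) ⇒ [ ⇑ t ] i ∶ □ φ
principle □-access     i t φ = [ t ] i ∶ □ φ ⇒ □ ([ ⇓ t ] i ∶ φ)
principle ○-access     i t φ = [ t ] i ∶ □ φ ⇒ [ ↓ t ] i ∶ ○ φ
principle ○-right      i t φ = [ t ] i ∶ ○ φ ⇒ ○ ([ ⇛ t ] i ∶ φ)
principle ○-left       i t φ = ○ ([ t ] i ∶ φ) ⇒ [ ⇚ t ] i ∶ ○ φ
principle ⊟-generalize i t φ = ⊟ ([ t ] i ∶ φ) ⇒ [ ⇑P t ] i ∶ ⊟ φ
principle ⊟-access     i t φ = [ t ] i ∶ ⊟ φ ⇒ ⊟ ([ ⇓P t ] i ∶ φ)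
principle Yw-access    i t φ = [ t ] i ∶ ⊟ φ ⇒ [ ↓P t ] i ∶ Yw φ
principle Yw-right     i t φ = [ t ] i ∶ Yw φ ⇒ Yw ([ ⇒P t ] i ∶ φ)
principle Ys-right     i t φ = [ t ] i ∶ Ys φ ⇒ Ys ([ ⇛P t ] i ∶ φ)
principle Ys-left      i t φ = Ys ([ t ] i ∶ φ) ⇒ [ ⇚P t ] i ∶ Ys φ

-- Provability in LPLTL^P(Ax)_CS, where Ax is a set of connecting principles
-- and CS a constant specification (a set of formulas).
data Prov {h : ℕ} (Ax : Principle → Set) (CS : Fm h → Set) : Fm h → Set where
  taut : ∀ {φ} → Tautology φ → Prov Ax CS φ
  ○-K  : ∀ φ ψ → Prov Ax CS (○ (φ ⇒ ψ) ⇒ (○ φ ⇒ ○ ψ))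
  □-K  : ∀ φ ψ → Prov Ax CS (□ (φ ⇒ ψ) ⇒ (□ φ ⇒ □ ψ))
  ○-fun : ∀ φ → Prov Ax CS (○ (¬' φ) ⇔ ¬' (○ φ))
  □-ind : ∀ φ → Prov Ax CS (□ (φ ⇒ ○ φ) ⇒ (φ ⇒ □ φ))
  U-◇  : ∀ φ ψ → Prov Ax CS ((φ 𝒰 ψ) ⇒ ◇ ψ)
  U-fix : ∀ φ ψ → Prov Ax CS ((φ 𝒰 ψ) ⇔ (ψ ∨' (φ ∧' ○ (φ 𝒰 ψ))))
  ⊟-K  : ∀ φ ψ → Prov Ax CS (⊟ (φ ⇒ ψ) ⇒ (⊟ φ ⇒ ⊟ ψ))
  Yw-K : ∀ φ ψ → Prov Ax CS (Yw (φ ⇒ ψ) ⇒ (Yw φ ⇒ Yw ψ))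
  Ys-Yw : ∀ φ → Prov Ax CS (Ys φ ⇒ Yw φ)
  ○Ys  : ∀ φ → Prov Ax CS (φ ⇒ ○ (Ys φ))
  Yw○  : ∀ φ → Prov Ax CS (φ ⇒ Yw (○ φ))
  start : Prov Ax CS (◇⁻ (Yw ⊥'))
  ⊟-ind : ∀ φ → Prov Ax CS (⊟ (φ ⇒ Yw φ) ⇒ (φ ⇒ ⊟ φ))
  S-◇⁻ : ∀ φ ψ → Prov Ax CS ((φ 𝒮 ψ) ⇒ ◇⁻ ψ)
  S-fix : ∀ φ ψ → Prov Ax CS ((φ 𝒮 ψ) ⇔ (ψ ∨' (φ ∧' Ys (φ 𝒮 ψ))))
  j-app : ∀ i t s φ ψ → Prov Ax CS ([ t ] i ∶ (φ ⇒ ψ) ⇒ ([ s ] i ∶ φ ⇒ [ t ⊙ s ] i ∶ ψ))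
  j-sumˡ : ∀ i t s φ → Prov Ax CS ([ t ] i ∶ φ ⇒ [ t ⊕ s ] i ∶ φ)
  j-sumʳ : ∀ i t s φ → Prov Ax CS ([ s ] i ∶ φ ⇒ [ t ⊕ s ] i ∶ φ)
  j-refl : ∀ i t φ → Prov Ax CS ([ t ] i ∶ φ ⇒ φ)
  j-intro : ∀ i t φ → Prov Ax CS ([ t ] i ∶ φ ⇒ [ ! t ] i ∶ ([ t ] i ∶ φ))
  conn : ∀ {p} → Ax p → ∀ i t φ → Prov Ax CS (principle p i t φ)
  mp   : ∀ {φ ψ} → Prov Ax CS (φ ⇒ ψ) → Prov Ax CS φ → Prov Ax CS ψ
  nec○  : ∀ {φ} → Prov Ax CS φ → Prov Ax CS (○ φ)
  necYw : ∀ {φ} → Prov Ax CS φ → Prov Ax CS (Yw φ)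
  nec□  : ∀ {φ} → Prov Ax CS φ → Prov Ax CS (□ φ)
  nec⊟  : ∀ {φ} → Prov Ax CS φ → Prov Ax CS (⊟ φ)
  cs    : ∀ {φ} → CS φ → Prov Ax CS φ

∅CS : {h : ℕ} → Fm h → Set
∅CS _ = ⊥

-- □-access turns [t]_i □φ into □[⇓t]_i φ; since □ψ → ○ψ is a theorem of the temporal
-- part alone, this yields ○[⇓t]_i φ, and ○-left pulls the next-operator inside the
-- justification, giving [⇚⇓t]_i ○φ.
module Submission where

open import Defs
open import Data.Nat using (ℕ; suc)
open import Data.Fin using (Fin)
open import Data.Product using (Σ; _,_)
open import Data.Bool using (true; false)
open import Relation.Binary.PropositionalEquality using (refl)

module _ {h : ℕ} {Ax : Principle → Set} {CS : Fm h → Set} where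

  private
    ⊢_ : Fm h → Set
    ⊢_ = Prov Ax CS

  ⇒-trans-taut : (a b c : Fm h) → Tautology ((a ⇒ b) ⇒ (b ⇒ c) ⇒ (a ⇒ c))
  ⇒-trans-taut a b c v with eval v a | eval v b | eval v c
  ... | true  | true  | true  = refl
  ... | true  | true  | false = refl
  ... | true  | false | true  = refl
  ... | true  | false | false = refl
  ... | false | true  | true  = refl
  ... | false | true  | false = refl
  ... | false | false | true  = refl
  ... | false | false | false = refl

  ⇔-from-taut : (a b : Fm h) → Tautology ((a ⇔ b) ⇒ (b ⇒ a))
  ⇔-from-taut a b v with eval v a | eval v b
  ... | true  | true  = refl
  ... | true  | false = refl
  ... | false | true  = refl
  ... | false | false = refl

  ∨-contraposeˡ-taut : (c d x : Fm h) → Tautology (((¬' c ∨' d) ⇒ x) ⇒ (¬' x ⇒ c))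
  ∨-contraposeˡ-taut c d x v with eval v c | eval v d | eval v x
  ... | true  | true  | true  = refl
  ... | true  | true  | false = refl
  ... | true  | false | true  = refl
  ... | true  | false | false = refl
  ... | false | true  | true  = refl
  ... | false | true  | false = refl
  ... | false | false | true  = refl
  ... | false | false | false = refl

  ∨-contraposeʳ-taut : (c d x : Fm h) → Tautology (((c ∨' (⊤' ∧' d)) ⇒ x) ⇒ (¬' x ⇒ ¬' d))
  ∨-contraposeʳ-taut c d x v with eval v c | eval v d | eval v x
  ... | true  | true  | true  = refl
  ... | true  | true  | false = refl
  ... | true  | false | true  = refl
  ... | true  | false | false = refl
  ... | false | true  | true  = refl
  ... | false | true  | false = refl
  ... | false | false | true  = refl
  ... | false | false | false = refl

  ⇒-trans : {a b c : Fm h} → ⊢ (a ⇒ b) → ⊢ (b ⇒ c) → ⊢ (a ⇒ c)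
  ⇒-trans {a} {b} {c} a⇒b b⇒c = mp (mp (taut (⇒-trans-taut a b c)) a⇒b) b⇒c

  ⇔-from : {a b : Fm h} → ⊢ (a ⇔ b) → ⊢ (b ⇒ a)
  ⇔-from {a} {b} a⇔b = mp (taut (⇔-from-taut a b)) a⇔b

  ◇-fold : (ψ : Fm h) → ⊢ ((ψ ∨' (⊤' ∧' ○ (◇ ψ))) ⇒ ◇ ψ)
  ◇-fold ψ = ⇔-from (U-fix ⊤' ψ)

  □-refl : (ψ : Fm h) → ⊢ (□ ψ ⇒ ψ)
  □-refl ψ = mp (taut (∨-contraposeˡ-taut ψ (⊤' ∧' ○ (◇ (¬' ψ))) (◇ (¬' ψ)))) (◇-fold (¬' ψ))

  □⇒○□ : (ψ : Fm h) → ⊢ (□ ψ ⇒ ○ (□ ψ))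
  □⇒○□ ψ = ⇒-trans ¬◇¬ψ⇒¬○◇¬ψ (⇔-from (○-fun (◇ (¬' ψ))))
    where
    ¬◇¬ψ⇒¬○◇¬ψ : ⊢ (□ ψ ⇒ ¬' (○ (◇ (¬' ψ))))
    ¬◇¬ψ⇒¬○◇¬ψ = mp (taut (∨-contraposeʳ-taut (¬' ψ) (○ (◇ (¬' ψ))) (◇ (¬' ψ))))
                    (◇-fold (¬' ψ))

  □⇒○ : (ψ : Fm h) → ⊢ (□ ψ ⇒ ○ ψ)
  □⇒○ ψ = ⇒-trans (□⇒○□ ψ) (mp (○-K (□ ψ) ψ) (nec○ (□-refl ψ)))

lemma20 : (h : ℕ) (Ax : Principle → Set) → Ax □-access → Ax ○-left →
          (i : Fin (suc h)) (φ : Fm (suc h)) (t : Term) →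
          Σ Term (λ s → Prov Ax ∅CS ([ t ] i ∶ □ φ ⇒ [ s ] i ∶ ○ φ))
lemma20 h Ax □-acc ○-lft i φ t = ⇚ (⇓ t) ,
  ⇒-trans (conn □-acc i t φ)
    (⇒-trans (□⇒○ ([ ⇓ t ] i ∶ φ))
             (conn ○-lft i (⇓ t) φ))
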